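{- Let $(M,\in_1,\in_2)\models ZFC(\in_1)\cup ZFC(\in_2)$. For all $x,y,f,f'\in M$: if $\psi(x,y,f)$ and $\psi(x,y,f')$ hold in $(M,\in_1,\in_2)$, then $f=f'$.
   Context: $ZFC(\in_1)$ denotes the first-order ZFC axioms with $\in_1$ as membership relation, where formulas in the schemas (Separation, Replacement) may contain both $\in_1$ and $\in_2$; $ZFC(\in_2)$ is symmetric. For $i=1,2$, $\mathrm{tr}_i(x)$ is the formula $\forall t\in_i x\,\forall w\in_i t\,(w\in_i x)$. $\mathrm{TC}_i(x)$ denotes the unique $u$ such that $\mathrm{tr}_i(u)$, $\forall v\in_i x\,(v\in_i u)$, and for every $v$ with $\mathrm{tr}_i(v)\wedge\forall w\in_i x\,(w\in_i v)$ we have $\forall w\in_i u\,(w\in_i v)$ (the $\in_i$-transitive closure of $x$); in $\mathrm{TC}_i(\{x\})$, $\{x\}$ is the singleton in the sense of $\in_i$. $\psi(x,y,f)$ is the conjunction of: (i) in the sense of $\in_1$, $f$ is a function with domain $\mathrm{TC}_1(\{x\})$; (ii) $\forall t\in_1\mathrm{TC}_1(x)\,(f(t)\in_2\mathrm{TC}_2(y))$; (iii) $\forall t\in_2\mathrm{TC}_2(y)\,\exists w\in_1\mathrm{TC}_1(x)\,(t=f(w))$; (iv) $\forall t\in_1\mathrm{TC}_1(x)\,\forall w\in_1\mathrm{TC}_1(\{x\})\,(t\in_1 w\leftrightarrow f(t)\in_2 f(w))$; (v) $f(x)=y$. Here function application $f(t)$ is in the sense of $\in_1$. -}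

module Defs where

open import Data.Nat using (ℕ; zero; suc)
open import Data.Product using (Σ; _×_; _,_; ∃-syntax)
open import Data.Sum using (_⊎_)
open import Data.Empty using (⊥)
open import Data.Unit using (⊤)
open import Relation.Nullary using (¬_)
open import Relation.Binary.PropositionalEquality using (_≡_)

infix 2 _⇔_
_⇔_ : Set → Set → Set
A ⇔ B = (A → B) × (B → A)

data Idx : Set where
  one two : Idx

-- First-order formulas over {=, ∈₁, ∈₂}, variables as de Bruijn indices

data Formula : Set where
  _≐_  : ℕ → ℕ → Formula
  mem  : Idx → ℕ → ℕ → Formula      -- mem i m n  means  v_m ∈_i v_n
  ⊥f   : Formula
  _∧f_ : Formula → Formula → Formula
  _∨f_ : Formula → Formula → Formula
  _⇒f_ : Formula → Formula → Formula
  ∀f   : Formula → Formula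
  ∃f   : Formula → Formula

record Structure : Set₁ where
  field
    M   : Set
    _∈⟨_⟩_ : M → Idx → M → Set

module _ (S : Structure) where
  open Structure S

  Env : Set
  Env = ℕ → M

  _∷ₑ_ : M → Env → Env
  (a ∷ₑ ρ) zero    = a
  (a ∷ₑ ρ) (suc n) = ρ n

  Sat : Env → Formula → Set
  Sat ρ (m ≐ n)     = ρ m ≡ ρ n
  Sat ρ (mem i m n) = ρ m ∈⟨ i ⟩ ρ n
  Sat ρ ⊥f          = ⊥
  Sat ρ (φ ∧f χ)    = Sat ρ φ × Sat ρ χ
  Sat ρ (φ ∨f χ)    = Sat ρ φ ⊎ Sat ρ χ
  Sat ρ (φ ⇒f χ)    = Sat ρ φ → Sat ρ χ
  Sat ρ (∀f φ)      = (a : M) → Sat (a ∷ₑ ρ) φ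
  Sat ρ (∃f φ)      = Σ M λ a → Sat (a ∷ₑ ρ) φ

  -- The ZFC axioms for membership ∈_i; the schemas range over all
  -- formulas of the full language {=, ∈₁, ∈₂}, with arbitrary parameters
  -- (given by the environment ρ).

  record ZFC (i : Idx) : Set where
    private
      _∈_ : M → M → Set
      x ∈ y = x ∈⟨ i ⟩ y
    field
      extensionality : ∀ a b → (∀ z → (z ∈ a) ⇔ (z ∈ b)) → a ≡ b
      foundation     : ∀ a → (Σ M λ y → y ∈ a) →
                       Σ M λ y → y ∈ a × (∀ z → z ∈ y → ¬ (z ∈ a))
      pairing        : ∀ a b → Σ M λ c → a ∈ c × b ∈ c
      union          : ∀ F → Σ M λ A → ∀ Y x → x ∈ Y → Y ∈ F → x ∈ A
      powerset       : ∀ x → Σ M λ y → ∀ z → (∀ w → w ∈ z → w ∈ x) → z ∈ y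
      infinity       : Σ M λ X →
                         (Σ M λ e → e ∈ X × (∀ z → ¬ (z ∈ e))) ×
                         (∀ y → y ∈ X → Σ M λ s → s ∈ X ×
                            (∀ z → (z ∈ s) ⇔ (z ∈ y ⊎ z ≡ y)))
      separation     : ∀ (φ : Formula) (ρ : Env) (a : M) →
                       Σ M λ b → ∀ z → (z ∈ b) ⇔ (z ∈ a × Sat (z ∷ₑ ρ) φ)
      -- Replacement: if φ(x, y, params) (x = variable 1, y = variable 0)
      -- defines y uniquely from each x ∈ A, the image exists (as a superset).
      replacement    : ∀ (φ : Formula) (ρ : Env) (A : M) →
                       (∀ x → x ∈ A →
                          Σ M λ y → Sat (y ∷ₑ (x ∷ₑ ρ)) φ ×
                            (∀ y' → Sat (y' ∷ₑ (x ∷ₑ ρ)) φ → y' ≡ y)) →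
                       Σ M λ B → ∀ x → x ∈ A →
                          Σ M λ y → y ∈ B × Sat (y ∷ₑ (x ∷ₑ ρ)) φ
      choice         : ∀ X → (∀ x → x ∈ X → Σ M λ w → w ∈ x) →
                       (∀ x y → x ∈ X → y ∈ X → ¬ (x ≡ y) →
                          ∀ z → ¬ (z ∈ x × z ∈ y)) →
                       Σ M λ C → ∀ x → x ∈ X →
                          Σ M λ z → (z ∈ x × z ∈ C) ×
                            (∀ z' → z' ∈ x → z' ∈ C → z' ≡ z)

  tr : Idx → M → Set
  tr i x = ∀ t → t ∈⟨ i ⟩ x → ∀ w → w ∈⟨ i ⟩ t → w ∈⟨ i ⟩ x

  IsTC : Idx → M → M → Set
  IsTC i x u = tr i u × (∀ v → v ∈⟨ i ⟩ x → v ∈⟨ i ⟩ u) ×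
               (∀ v → tr i v → (∀ w → w ∈⟨ i ⟩ x → w ∈⟨ i ⟩ v) →
                  ∀ w → w ∈⟨ i ⟩ u → w ∈⟨ i ⟩ v)

  IsUPair : Idx → M → M → M → Set
  IsUPair i z a b = ∀ w → (w ∈⟨ i ⟩ z) ⇔ (w ≡ a ⊎ w ≡ b)

  IsSingleton : Idx → M → M → Set
  IsSingleton i z a = IsUPair i z a a

  IsPair₁ : M → M → M → Set
  IsPair₁ p a b = ∀ z → (z ∈⟨ one ⟩ p) ⇔
                        (IsSingleton one z a ⊎ IsUPair one z a b)

  App₁ : M → M → M → Set
  App₁ f t v = Σ M λ p → p ∈⟨ one ⟩ f × IsPair₁ p t v

  IsFunctionWithDomain₁ : M → M → Set
  IsFunctionWithDomain₁ f d =
    (∀ p → p ∈⟨ one ⟩ f → Σ M λ a → Σ M λ b → IsPair₁ p a b) ×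
    (∀ a b b' → App₁ f a b → App₁ f a b' → b ≡ b') ×
    (∀ a → (a ∈⟨ one ⟩ d) ⇔ (Σ M λ b → App₁ f a b))

  -- The definite descriptions TC₁({x}), TC₁(x), TC₂(y)
  -- (which exist uniquely in any model of ZFC(∈₁) ∪ ZFC(∈₂)) are
  -- rendered by naming them: s = {x}₁, a = TC₁(s), b = TC₁(x), c = TC₂(y).
  -- Since f is a function (clause (i)), "f(t) = v" is rendered as App₁ f t v.
  ψ : M → M → M → Set
  ψ x y f =
    Σ M λ s → Σ M λ a → Σ M λ b → Σ M λ c →
      IsSingleton one s x × IsTC one s a × IsTC one x b × IsTC two y c ×
      IsFunctionWithDomain₁ f a ×
      (∀ t → t ∈⟨ one ⟩ b → ∀ v → App₁ f t v → v ∈⟨ two ⟩ c) ×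
      (∀ t → t ∈⟨ two ⟩ c → Σ M λ w → w ∈⟨ one ⟩ b × App₁ f w t) ×
      (∀ t w → t ∈⟨ one ⟩ b → w ∈⟨ one ⟩ a →
         ∀ vt vw → App₁ f t vt → App₁ f w vw →
         (t ∈⟨ one ⟩ w) ⇔ (vt ∈⟨ two ⟩ vw)) ×
      App₁ f x y

-- f and f' both map (TC₁({x}), ∈₁) isomorphically onto (TC₂({y}), ∈₂) with x ↦ y.
-- By ∈₁-induction on t ∈ TC₁({x}) one shows f(t) = f'(t): an element u ∈₂ f(t) lies
-- in TC₂(y), so u = f(w) for some w ∈₁ TC₁(x), and w ∈₁ t because f reflects
-- membership; by induction f'(w) = u, and f' preserves membership, so u ∈₂ f'(t).
-- Symmetrically f'(t) ⊆₂ f(t), and ∈₂-extensionality gives f(t) = f'(t). Since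
-- "f and f' agree at t" is first-order, Separation and Foundation (read classically)
-- provide this induction principle, and f = f' by ∈₁-extensionality.
module Submission where

open import Defs
open import Level using (0ℓ)
open import Axiom.ExcludedMiddle using (ExcludedMiddle)
open import Relation.Binary.PropositionalEquality using (_≡_; refl; sym; subst)
open import Data.Nat using (ℕ; zero; suc)
open import Data.Product using (Σ; _×_; _,_; proj₁; proj₂)
open import Data.Sum using (_⊎_; inj₁; inj₂; reduce)
open import Function using (_∘_)
open import Relation.Nullary using (¬_)
open import Relation.Nullary.Decidable using (decidable-stable)

_⇔f_ : Formula → Formula → Formula
φ ⇔f χ = (φ ⇒f χ) ∧f (χ ⇒f φ)

upairF : ℕ → ℕ → ℕ → Formula
upairF z a b = ∀f (mem one 0 (suc z) ⇔f ((0 ≐ suc a) ∨f (0 ≐ suc b)))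

pairF : ℕ → ℕ → ℕ → Formula
pairF p a b = ∀f (mem one 0 (suc p) ⇔f (upairF 0 (suc a) (suc a) ∨f upairF 0 (suc a) (suc b)))

appF : ℕ → ℕ → ℕ → Formula
appF f t v = ∃f (mem one 0 (suc f) ∧f pairF 0 (suc t) (suc v))

-- Expresses Agree f g t, with t, f, g in variables 0, 1, 2.
agreeF : Formula
agreeF = ∀f (∀f ((appF 3 2 1 ∧f appF 4 2 0) ⇒f (1 ≐ 0)))

module _ {S : Structure} where
  open Structure S

  _⊆⟨_⟩_ : M → Idx → M → Set
  a ⊆⟨ i ⟩ b = ∀ w → w ∈⟨ i ⟩ a → w ∈⟨ i ⟩ b

  Holds : Formula → Env S → M → Set
  Holds φ ρ t = Sat S (_∷ₑ_ S t ρ) φ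

  singleton-member : ∀ {i s x w} → IsSingleton S i s x → w ∈⟨ i ⟩ s → w ≡ x
  singleton-member sg = reduce ∘ proj₁ (sg _)

  module _ {i} (Z : ZFC S i) where
    open ZFC Z

    ≡-by-members : ∀ {P : M → Set} {z z'} →
                   (∀ w → (w ∈⟨ i ⟩ z) ⇔ P w) → (∀ w → (w ∈⟨ i ⟩ z') ⇔ P w) → z ≡ z'
    ≡-by-members {z = z} {z'} hz hz' = extensionality z z' λ w →
      proj₂ (hz' w) ∘ proj₁ (hz w) , proj₂ (hz w) ∘ proj₁ (hz' w)

    IsTC-unique : ∀ {x u u'} → IsTC S i x u → IsTC S i x u' → u ≡ u'
    IsTC-unique {u = u} {u'} (tr-u , x⊆u , u-least) (tr-u' , x⊆u' , u'-least) =
      extensionality u u' λ w → u-least u' tr-u' x⊆u' w , u'-least u tr-u x⊆u w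

    module _ {x s a b} (sg : IsSingleton S i s x) (tcs : IsTC S i s a) (tcx : IsTC S i x b) where

      ∈-TC-singleton : x ∈⟨ i ⟩ a
      ∈-TC-singleton = proj₁ (proj₂ tcs) x (proj₂ (sg x) (inj₁ refl))

      TC-⊆-TC-singleton : b ⊆⟨ i ⟩ a
      TC-⊆-TC-singleton = proj₂ (proj₂ tcx) a (proj₁ tcs) (proj₁ tcs x ∈-TC-singleton)

      TC-singleton-cases : ∀ t → t ∈⟨ i ⟩ a → t ≡ x ⊎ t ∈⟨ i ⟩ b
      TC-singleton-cases t t∈a = proj₂ (proj₁ (E-spec t) (a⊆E t t∈a))
        where
          E-sep = separation ((0 ≐ 1) ∨f mem i 0 2) (λ { zero → x ; (suc _) → b }) a
          E = proj₁ E-sep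
          E-spec : ∀ z → (z ∈⟨ i ⟩ E) ⇔ (z ∈⟨ i ⟩ a × (z ≡ x ⊎ z ∈⟨ i ⟩ b))
          E-spec = proj₂ E-sep

          E-transitive : tr S i E
          E-transitive t' t'∈E w w∈t' with proj₁ (E-spec t') t'∈E
          ... | t'∈a , inj₁ refl = proj₂ (E-spec w) (proj₁ tcs t' t'∈a w w∈t' , inj₂ (proj₁ (proj₂ tcx) w w∈t'))
          ... | t'∈a , inj₂ t'∈b = proj₂ (E-spec w) (proj₁ tcs t' t'∈a w w∈t' , inj₂ (proj₁ tcx t' t'∈b w w∈t'))

          a⊆E : a ⊆⟨ i ⟩ E
          a⊆E = proj₂ (proj₂ tcs) E E-transitive λ w w∈s →
            proj₂ (E-spec w) (subst (λ z → z ∈⟨ i ⟩ a) (sym (singleton-member sg w∈s)) ∈-TC-singleton ,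
                              inj₁ (singleton-member sg w∈s))

  ∈-induction : ExcludedMiddle 0ℓ → ∀ {i} → ZFC S i → ∀ φ ρ a →
                (∀ t → t ∈⟨ i ⟩ a → (∀ w → w ∈⟨ i ⟩ t → w ∈⟨ i ⟩ a → Holds φ ρ w) → Holds φ ρ t) →
                ∀ t → t ∈⟨ i ⟩ a → Holds φ ρ t
  ∈-induction em {i} Z φ ρ a step t t∈a =
    decidable-stable em λ ¬φt → no-counterexample t (proj₂ (D-spec t) (t∈a , ¬φt))
    where
      open ZFC Z
      D-sep = separation (φ ⇒f ⊥f) ρ a
      D = proj₁ D-sep
      D-spec : ∀ z → (z ∈⟨ i ⟩ D) ⇔ (z ∈⟨ i ⟩ a × ¬ Holds φ ρ z)
      D-spec = proj₂ D-sep

      no-counterexample : ∀ z → ¬ z ∈⟨ i ⟩ D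
      no-counterexample z z∈D with foundation D (z , z∈D)
      ... | m , m∈D , m-minimal with proj₁ (D-spec m) m∈D
      ... | m∈a , ¬φm = ¬φm (step m m∈a λ w w∈m w∈a →
              decidable-stable em λ ¬φw → m-minimal w w∈m (proj₂ (D-spec w) (w∈a , ¬φw)))

  Agree : M → M → M → Set
  Agree f g t = ∀ v v' → App₁ S f t v × App₁ S g t v' → v ≡ v'

  Agree-sym : ∀ {f g t} → Agree f g t → Agree g f t
  Agree-sym agree v v' (gtv , ftv') = sym (agree v' v (ftv' , gtv))

  module _ (Z1 : ZFC S one) where

    graph-⊆ : ∀ {f g d} → IsFunctionWithDomain₁ S f d → IsFunctionWithDomain₁ S g d →
              (∀ t → t ∈⟨ one ⟩ d → Agree f g t) → f ⊆⟨ one ⟩ g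
    graph-⊆ {g = g} (pairs , _ , dom-f) (_ , _ , dom-g) agree p p∈f with pairs p p∈f
    ... | t , v , p≐tv with proj₂ (dom-f t) (v , p , p∈f , p≐tv)
    ... | t∈d with proj₁ (dom-g t) t∈d
    ... | v' , p' , p'∈g , p'≐tv' with agree t t∈d v v' ((p , p∈f , p≐tv) , (p' , p'∈g , p'≐tv'))
    ... | refl = subst (λ q → q ∈⟨ one ⟩ g) (≡-by-members Z1 p'≐tv' p≐tv) p'∈g

    function-ext₁ : ∀ {f g d} → IsFunctionWithDomain₁ S f d → IsFunctionWithDomain₁ S g d →
                    (∀ t → t ∈⟨ one ⟩ d → Agree f g t) → f ≡ g
    function-ext₁ {f} {g} fd gd agree = ZFC.extensionality Z1 f g λ p →
      graph-⊆ fd gd agree p , graph-⊆ gd fd (λ t t∈d → Agree-sym (agree t t∈d)) p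

  module Iso (em : ExcludedMiddle 0ℓ) (Z1 : ZFC S one) (Z2 : ZFC S two) {x y s a b c : M}
               (sg : IsSingleton S one s x) (tcs : IsTC S one s a)
               (tcx : IsTC S one x b) (tcy : IsTC S two y c) where
    _∈₁_ _∈₂_ : M → M → Set
    u ∈₁ v = u ∈⟨ one ⟩ v
    u ∈₂ v = u ∈⟨ two ⟩ v

    record IsIso (f : M) : Set where
      field
        function : IsFunctionWithDomain₁ S f a
        into     : ∀ t → t ∈₁ b → ∀ v → App₁ S f t v → v ∈₂ c
        onto     : ∀ t → t ∈₂ c → Σ M λ w → w ∈₁ b × App₁ S f w t
        ∈-iso    : ∀ t w → t ∈₁ b → w ∈₁ a → ∀ vt vw → App₁ S f t vt → App₁ S f w vw →
                   (t ∈₁ w) ⇔ (vt ∈₂ vw)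
        root     : App₁ S f x y

      single-valued : ∀ {t v v'} → App₁ S f t v → App₁ S f t v' → v ≡ v'
      single-valued = proj₁ (proj₂ function) _ _ _

      total : ∀ {t} → t ∈₁ a → Σ M (App₁ S f t)
      total = proj₁ (proj₂ (proj₂ function) _)

    open IsIso

    b⊆a : b ⊆⟨ one ⟩ a
    b⊆a = TC-⊆-TC-singleton Z1 sg tcs tcx

    value-⊆-TC : ∀ {f t v} → IsIso f → t ∈₁ a → App₁ S f t v → v ⊆⟨ two ⟩ c
    value-⊆-TC iso t∈a ftv with TC-singleton-cases Z1 sg tcs tcx _ t∈a
    ... | inj₁ refl = λ u u∈v →
            proj₁ (proj₂ tcy) u (subst (u ∈₂_) (single-valued iso ftv (root iso)) u∈v)
    ... | inj₂ t∈b = proj₁ tcy _ (into iso _ t∈b _ ftv)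

    value-⊆ : ∀ {f g t v v'} → IsIso f → IsIso g → t ∈₁ a →
              (∀ w → w ∈₁ t → w ∈₁ a → Agree f g w) →
              App₁ S f t v → App₁ S g t v' → v ⊆⟨ two ⟩ v'
    value-⊆ {t = t} {v} {v'} isof isog t∈a IH ftv gtv' u u∈v
      with onto isof u (value-⊆-TC isof t∈a ftv u u∈v)
    ... | w , w∈b , fwu with total isog (b⊆a w w∈b)
    ... | u' , gwu' =
      subst (_∈₂ v') (sym (IH w w∈t w∈a u u' (fwu , gwu')))
            (proj₁ (∈-iso isog w t w∈b t∈a u' v' gwu' gtv') w∈t)
      where
        w∈a = b⊆a w w∈b
        w∈t = proj₂ (∈-iso isof w t w∈b t∈a u v fwu ftv) u∈v

    Agree-step : ∀ {f g t} → IsIso f → IsIso g → t ∈₁ a →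
                 (∀ w → w ∈₁ t → w ∈₁ a → Agree f g w) → Agree f g t
    Agree-step isof isog t∈a IH v v' (ftv , gtv') = ZFC.extensionality Z2 v v' λ u →
      value-⊆ isof isog t∈a IH ftv gtv' u ,
      value-⊆ isog isof t∈a (λ w w∈t w∈a → Agree-sym (IH w w∈t w∈a)) gtv' ftv u

    -- Agree f g t is, definitionally, Holds agreeF (f , g) t.
    IsIso-unique : ∀ {f g} → IsIso f → IsIso g → f ≡ g
    IsIso-unique {f} {g} isof isog =
      function-ext₁ Z1 (function isof) (function isog)
        (∈-induction em Z1 agreeF (λ { zero → f ; (suc _) → g }) a λ _ → Agree-step isof isog)

lemma1 : ExcludedMiddle 0ℓ → (S : Structure) → ZFC S one → ZFC S two →
    ∀ (x y f f' : Structure.M S) →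
    ψ S x y f → ψ S x y f' → f ≡ f'
lemma1 em S Z1 Z2 x y f f'
  (s , a , b , c , sg , tcs , tcx , tcy , fd , into , onto , ∈-iso , root)
  (s' , a' , b' , c' , sg' , tcs' , tcx' , tcy' , fd' , into' , onto' , ∈-iso' , root')
  with ≡-by-members Z1 sg sg'
... | refl with IsTC-unique Z1 tcs tcs' | IsTC-unique Z1 tcx tcx' | IsTC-unique Z2 tcy tcy'
... | refl | refl | refl =
  IsIso-unique (record { function = fd ; into = into ; onto = onto ; ∈-iso = ∈-iso ; root = root })
               (record { function = fd' ; into = into' ; onto = onto' ; ∈-iso = ∈-iso' ; root = root' })
  where open Iso em Z1 Z2 sg tcs tcx tcy
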